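{- If a cyclic sentence $W$ in the letters $\{A,X,B\}$ contains the string $XB$ (cyclically consecutive), then $|W|=0$.
   Context: A cyclic sentence of length $N$ is a string of length $N$ in the letters $A,X,B$ considered up to cyclic permutation. Words with (coefficient, weight): $X$ $(1,0)$; $XA$ $(1,1)$; $XAA$ $(1,1)$; $XBA$ $(1,1)$; $AXA$ $(2,1)$; $AAA$ $(-1,1)$; $BA$ $(-1,1)$; $ABA$ $(-1,1)$; $XXA$ $(-2,1)$. A parsing of a cyclic sentence is a decomposition of the cyclic string into consecutive blocks each equal to one of these words; its coefficient is the product and its weight the sum of those of its words. With $c(S,w)$ the sum of coefficients of parsings of weight $w$, $|S|=\sum_{w\ge0}c(S,w)t^w$. -}

module Defs where

open import Data.Nat using (ℕ; zero; suc; _<_; _+_; _∸_; _<ᵇ_; _≡ᵇ_)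
open import Data.Integer using (ℤ; +_; -_; _*_) renaming (_+_ to _+ℤ_)
open import Data.List using (List; []; _∷_; _++_; map; concatMap; length; drop; take; upTo; filterᵇ; foldr)
open import Data.Bool using (Bool; true; false; _∨_; if_then_else_)
open import Data.Maybe using (Maybe; just; nothing)
open import Data.Product using (_×_; _,_; ∃; proj₁; proj₂)
open import Relation.Binary.PropositionalEquality using (_≡_)

data Letter : Set where
  A X B : Letter

_==_ : Letter → Letter → Bool
A == A = true
X == X = true
B == B = true
_ == _ = false

data Word : Set where
  wX wXA wXAA wXBA wAXA wAAA wBA wABA wXXA : Word

allWords : List Word
allWords = wX ∷ wXA ∷ wXAA ∷ wXBA ∷ wAXA ∷ wAAA ∷ wBA ∷ wABA ∷ wXXA ∷ []

spell : Word → List Letter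
spell wX   = X ∷ []
spell wXA  = X ∷ A ∷ []
spell wXAA = X ∷ A ∷ A ∷ []
spell wXBA = X ∷ B ∷ A ∷ []
spell wAXA = A ∷ X ∷ A ∷ []
spell wAAA = A ∷ A ∷ A ∷ []
spell wBA  = B ∷ A ∷ []
spell wABA = A ∷ B ∷ A ∷ []
spell wXXA = X ∷ X ∷ A ∷ []

coef : Word → ℤ
coef wX   = + 1
coef wXA  = + 1
coef wXAA = + 1
coef wXBA = + 1
coef wAXA = + 2
coef wAAA = - (+ 1)
coef wBA  = - (+ 1)
coef wABA = - (+ 1)
coef wXXA = - (+ 2)

weight : Word → ℕ
weight wX = 0
weight _  = 1

stripPrefix : List Letter → List Letter → Maybe (List Letter)
stripPrefix []       s        = just s
stripPrefix (_ ∷ _)  []       = nothing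
stripPrefix (a ∷ p)  (b ∷ s)  = if a == b then stripPrefix p s else nothing

-- The fuel argument n is taken to be the
-- length of the string; since every word is nonempty this is enough.
linParsings : ℕ → List Letter → List (List Word)
linParsings _       []       = [] ∷ []
linParsings zero    (_ ∷ _)  = []
linParsings (suc n) s@(_ ∷ _) = concatMap step allWords
  where
  step : Word → List (List Word)
  step w with stripPrefix (spell w) s
  ... | nothing   = []
  ... | just rest = map (w ∷_) (linParsings n rest)

rotate : ℕ → List Letter → List Letter
rotate r s = drop r s ++ take r s

-- A parsing of the cyclic string represented by s (positions 0..N-1,
-- N = length s) is a decomposition into cyclically consecutive blocks.
-- We represent it uniquely by the start position r of the block covering
-- position 0 together with the list of blocks read from r onwards.
coversZero : ℕ → ℕ → List Word → Bool
coversZero N r []      = false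
coversZero N r (w ∷ _) = (r ≡ᵇ 0) ∨ ((N ∸ r) <ᵇ length (spell w))

cycParsings : List Letter → List (List Word)
cycParsings s = concatMap atR (upTo (length s))
  where
  atR : ℕ → List (List Word)
  atR r = filterᵇ (coversZero (length s) r)
                  (linParsings (length s) (rotate r s))

parsingCoef : List Word → ℤ
parsingCoef ws = foldr (λ w c → coef w * c) (+ 1) ws

parsingWeight : List Word → ℕ
parsingWeight ws = foldr (λ w k → weight w + k) 0 ws

c : List Letter → ℕ → ℤ
c s w = foldr (λ ws acc → (if parsingWeight ws ≡ᵇ w then parsingCoef ws else + 0) +ℤ acc)
              (+ 0) (cycParsings s)

-- |S| = 0 as a polynomial in t: every coefficient c(S,w) vanishes
IsZeroPoly : List Letter → Set
IsZeroPoly s = ∀ (w : ℕ) → c s w ≡ + 0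

ContainsXB : List Letter → Set
ContainsXB s = ∃ λ r → (r < length s) × ∃ λ rest → rotate r s ≡ X ∷ B ∷ rest

private
  open import Relation.Binary.PropositionalEquality using (refl)
  t1 : c (X ∷ []) 0 ≡ + 1
  t1 = refl
  t2 : c (X ∷ A ∷ []) 1 ≡ + 1
  t2 = refl
  t3 : c (X ∷ X ∷ []) 0 ≡ + 1
  t3 = refl
  t4 : c (A ∷ X ∷ A ∷ []) 1 ≡ + 3
  t4 = refl
  t5 : c (X ∷ B ∷ A ∷ X ∷ A ∷ []) 2 ≡ + 0
  t5 = refl

module Submission where

-- A cyclic parsing is recorded by the start r of the block covering position
-- 0 and the linear parsing of the rotation of S starting at r, so c(S, w) is
-- a sum over rotations (c-as-sum).  Each linear parsing through an occurrence
-- X·B·A·m either uses the word XBA there or the words X and BA; these have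
-- the same weight and opposite coefficients and cancel.  Hence every linear
-- string containing XB has null generating sum (linear-null), and so does a
-- rotation containing XB after its first letter, whatever the first block is
-- (tail-null).  Only the two rotations starting at the X and at the B of one
-- occurrence remain; their surviving parsings again cancel, because the block
-- XBA covers position 0 exactly when X or BA does (Splits, pair-cancel).

open import Defs
open import Function using (_∘_)
open import Data.Bool using (Bool; true; false; if_then_else_; T?)
open import Data.Empty using (⊥; ⊥-elim)
open import Data.Integer using (ℤ; +_; -_; _*_) renaming (_+_ to _+ℤ_)
open import Data.Integer.Properties
  using (+-identityˡ; +-identityʳ; +-assoc; +-inverseˡ; +-inverseʳ; +-comm; *-identityˡ; *-zeroʳ; *-distribˡ-+; -1*i≡-i)
open import Data.List
  using (List; []; _∷_; _++_; map; concatMap; length; drop; take; applyUpTo; filterᵇ; foldr)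
open import Data.List.Properties
  using (++-identityʳ; ++-assoc; length-++; length-++-comm; length-drop; length-take; take++drop≡id; concatMap-cong; filter-++)
open import Data.Maybe using (Maybe; just; nothing)
open import Data.Nat using (ℕ; zero; suc; _<_; _≤_; _+_; _∸_; _⊓_; _≡ᵇ_; z≤n; s≤s)
open import Data.Nat.Properties using (≤-refl; ≤-trans; ≤-reflexive; <⇒≤; m≤n⇒m≤1+n; m⊓n+n∸m≡n; n≮0; m<n⇒0<n∸m)
import Data.Nat.Properties as ℕ
open import Data.Product using (_,_; ∃₂)
open import Data.Unit using (⊤; tt)
open import Relation.Binary.PropositionalEquality

branch : Word → Maybe (List Letter) → (List Letter → List (List Word)) → List (List Word)
branch wd nothing  parse = []
branch wd (just r) parse = map (wd ∷_) (parse r)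

expand : (List Letter → List (List Word)) → List Letter → List (List Word)
expand parse s = concatMap (λ wd → branch wd (stripPrefix (spell wd) s) parse) allWords

-- linParsings is one expand step on a nonempty string.  This holds by
-- computation once the first three letters are known (words have length ≤ 3).
linParsings-unfold : ∀ n a t → linParsings (suc n) (a ∷ t) ≡ expand (linParsings n) (a ∷ t)
linParsings-unfold n A []          = refl
linParsings-unfold n A (A ∷ [])    = refl
linParsings-unfold n A (A ∷ A ∷ t) = refl
linParsings-unfold n A (A ∷ X ∷ t) = refl
linParsings-unfold n A (A ∷ B ∷ t) = refl
linParsings-unfold n A (X ∷ [])    = refl
linParsings-unfold n A (X ∷ A ∷ t) = refl
linParsings-unfold n A (X ∷ X ∷ t) = refl
linParsings-unfold n A (X ∷ B ∷ t) = refl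
linParsings-unfold n A (B ∷ [])    = refl
linParsings-unfold n A (B ∷ A ∷ t) = refl
linParsings-unfold n A (B ∷ X ∷ t) = refl
linParsings-unfold n A (B ∷ B ∷ t) = refl
linParsings-unfold n X []          = refl
linParsings-unfold n X (A ∷ [])    = refl
linParsings-unfold n X (A ∷ A ∷ t) = refl
linParsings-unfold n X (A ∷ X ∷ t) = refl
linParsings-unfold n X (A ∷ B ∷ t) = refl
linParsings-unfold n X (X ∷ [])    = refl
linParsings-unfold n X (X ∷ A ∷ t) = refl
linParsings-unfold n X (X ∷ X ∷ t) = refl
linParsings-unfold n X (X ∷ B ∷ t) = refl
linParsings-unfold n X (B ∷ [])    = refl
linParsings-unfold n X (B ∷ A ∷ t) = refl
linParsings-unfold n X (B ∷ X ∷ t) = refl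
linParsings-unfold n X (B ∷ B ∷ t) = refl
linParsings-unfold n B []          = refl
linParsings-unfold n B (A ∷ [])    = refl
linParsings-unfold n B (A ∷ A ∷ t) = refl
linParsings-unfold n B (A ∷ X ∷ t) = refl
linParsings-unfold n B (A ∷ B ∷ t) = refl
linParsings-unfold n B (X ∷ [])    = refl
linParsings-unfold n B (X ∷ A ∷ t) = refl
linParsings-unfold n B (X ∷ X ∷ t) = refl
linParsings-unfold n B (X ∷ B ∷ t) = refl
linParsings-unfold n B (B ∷ [])    = refl
linParsings-unfold n B (B ∷ A ∷ t) = refl
linParsings-unfold n B (B ∷ X ∷ t) = refl
linParsings-unfold n B (B ∷ B ∷ t) = refl

data HasXB : List Letter → Set where
  here  : ∀ v → HasXB (X ∷ B ∷ v)
  there : ∀ a {t} → HasXB t → HasXB (a ∷ t)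

data TailHasXB : List Letter → Set where
  after : ∀ a {t} → HasXB t → TailHasXB (a ∷ t)

HasXB-++ˡ : ∀ p {t} → HasXB t → HasXB (p ++ t)
HasXB-++ˡ []      h = h
HasXB-++ˡ (a ∷ p) h = there a (HasXB-++ˡ p h)

HasXB-++ʳ : ∀ {t} z → HasXB t → HasXB (t ++ z)
HasXB-++ʳ z (here v)    = here (v ++ z)
HasXB-++ʳ z (there a h) = there a (HasXB-++ʳ z h)

-- p is X-guarded if every X in p is followed, inside p, by A or X.  Matching
-- such a p against a string never consumes the X of an occurrence of XB.
XGuarded : List Letter → Set
XGuarded []          = ⊤
XGuarded (A ∷ p)     = XGuarded p
XGuarded (B ∷ p)     = XGuarded p
XGuarded (X ∷ [])    = ⊥
XGuarded (X ∷ A ∷ p) = XGuarded (A ∷ p)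
XGuarded (X ∷ X ∷ p) = XGuarded (X ∷ p)
XGuarded (X ∷ B ∷ p) = ⊥

snoc-X-unguarded : ∀ t → XGuarded (t ++ X ∷ []) → ⊥
snoc-X-unguarded []          ()
snoc-X-unguarded (A ∷ t)     g = snoc-X-unguarded t g
snoc-X-unguarded (B ∷ t)     g = snoc-X-unguarded t g
snoc-X-unguarded (X ∷ [])    ()
snoc-X-unguarded (X ∷ A ∷ t) g = snoc-X-unguarded (A ∷ t) g
snoc-X-unguarded (X ∷ X ∷ t) g = snoc-X-unguarded (X ∷ t) g
snoc-X-unguarded (X ∷ B ∷ t) ()

XGuarded-tail : ∀ x p → XGuarded (x ∷ p) → XGuarded p
XGuarded-tail A p       g = g
XGuarded-tail B p       g = g
XGuarded-tail X (A ∷ p) g = g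
XGuarded-tail X (X ∷ p) g = g
XGuarded-tail X []      ()
XGuarded-tail X (B ∷ p) ()

data WordShape : List Letter → Set where
  shape : ∀ x p → XGuarded p → WordShape (x ∷ p)

spell-shape : ∀ wd → WordShape (spell wd)
spell-shape wX   = shape X [] tt
spell-shape wXA  = shape X (A ∷ []) tt
spell-shape wXAA = shape X (A ∷ A ∷ []) tt
spell-shape wXBA = shape X (B ∷ A ∷ []) tt
spell-shape wAXA = shape A (X ∷ A ∷ []) tt
spell-shape wAAA = shape A (A ∷ A ∷ []) tt
spell-shape wBA  = shape B (A ∷ []) tt
spell-shape wABA = shape A (B ∷ A ∷ []) tt
spell-shape wXXA = shape X (X ∷ A ∷ []) tt

==⇒≡ : ∀ x y → (x == y) ≡ true → x ≡ y
==⇒≡ A A _ = refl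
==⇒≡ X X _ = refl
==⇒≡ B B _ = refl
==⇒≡ A X ()
==⇒≡ A B ()
==⇒≡ X A ()
==⇒≡ X B ()
==⇒≡ B A ()
==⇒≡ B X ()

strip-length : ∀ p s {r} → stripPrefix p s ≡ just r → length r ≤ length s
strip-length []      s       refl = ≤-refl
strip-length (x ∷ p) []      ()
strip-length (x ∷ p) (b ∷ s) eq with x == b
... | true  = m≤n⇒m≤1+n (strip-length p s eq)
strip-length (x ∷ p) (b ∷ s) () | false

strip-word-length : ∀ {p} a t {r} → WordShape p → stripPrefix p (a ∷ t) ≡ just r → length r ≤ length t
strip-word-length a t (shape x p _) eq with x == a
... | true  = strip-length p t eq
strip-word-length a t (shape x p _) () | false

strip-keeps-XB : ∀ p {t r} → XGuarded p → HasXB t → stripPrefix p t ≡ just r → HasXB r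
strip-keeps-XB []          g  h           refl = h
strip-keeps-XB (X ∷ [])    () h           eq
strip-keeps-XB (X ∷ B ∷ p) () h           eq
strip-keeps-XB (A ∷ p)     g (here v)     ()
strip-keeps-XB (B ∷ p)     g (here v)     ()
strip-keeps-XB (X ∷ A ∷ p) g (here v)     ()
strip-keeps-XB (X ∷ X ∷ p) g (here v)     ()
strip-keeps-XB (x ∷ p)     g (there a h)  eq with x == a
... | true  = strip-keeps-XB p (XGuarded-tail x p g) h eq
strip-keeps-XB (x ∷ p) g (there a h) () | false

strip-word-keeps-XB : ∀ {p t r} → WordShape p → TailHasXB t → stripPrefix p t ≡ just r → HasXB r
strip-word-keeps-XB (shape x p g) (after a h) eq with x == a
... | true  = strip-keeps-XB p g h eq
strip-word-keeps-XB (shape x p g) (after a h) () | false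

strip-++ : ∀ p u y {r} → stripPrefix p u ≡ just r → stripPrefix p (u ++ y) ≡ just (r ++ y)
strip-++ []      u       y refl = refl
strip-++ (x ∷ p) []      y ()
strip-++ (x ∷ p) (b ∷ u) y eq with x == b
... | true  = strip-++ p u y eq
strip-++ (x ∷ p) (b ∷ u) y () | false

strip-snoc-X : ∀ p u → stripPrefix p u ≡ nothing → p ≢ u ++ X ∷ [] → stripPrefix p (u ++ X ∷ []) ≡ nothing
strip-snoc-X []          u       ()
strip-snoc-X (X ∷ [])    []      _  p≢ = ⊥-elim (p≢ refl)
strip-snoc-X (X ∷ _ ∷ p) []      _  _  = refl
strip-snoc-X (A ∷ p)     []      _  _  = refl
strip-snoc-X (B ∷ p)     []      _  _  = refl
strip-snoc-X (x ∷ p)     (b ∷ u) eq p≢ with x == b in e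
... | true  = strip-snoc-X p u eq (λ p≡ → p≢ (cong₂ _∷_ (==⇒≡ x b e) p≡))
... | false = refl

-- No word has the form (a ∷ t) ++ [X]: words of length ≥ 2 end in A.
word-not-snoc-X : ∀ {p} a t → WordShape p → p ≢ (a ∷ t) ++ X ∷ []
word-not-snoc-X a t (shape x p g) refl = snoc-X-unguarded t g

expand-cong : ∀ f g s → (∀ wd {r} → stripPrefix (spell wd) s ≡ just r → f r ≡ g r) →
              expand f s ≡ expand g s
expand-cong f g s f≡g = concatMap-cong branch-cong allWords
  where
  branch-cong : ∀ wd → branch wd (stripPrefix (spell wd) s) f ≡ branch wd (stripPrefix (spell wd) s) g
  branch-cong wd with stripPrefix (spell wd) s in eq
  ... | nothing = refl
  ... | just r  = cong (map (wd ∷_)) (f≡g wd eq)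

linParsings-fuel : ∀ n s → length s ≤ n → linParsings (suc n) s ≡ linParsings n s
linParsings-fuel n       []      _         = refl
linParsings-fuel (suc n) (a ∷ t) (s≤s le) = begin
  linParsings (suc (suc n)) (a ∷ t)    ≡⟨ linParsings-unfold (suc n) a t ⟩
  expand (linParsings (suc n)) (a ∷ t) ≡⟨ expand-cong _ _ (a ∷ t) shorter ⟩
  expand (linParsings n) (a ∷ t)       ≡⟨ sym (linParsings-unfold n a t) ⟩
  linParsings (suc n) (a ∷ t)          ∎
  where
  open ≡-Reasoning
  shorter : ∀ wd {r} → stripPrefix (spell wd) (a ∷ t) ≡ just r → linParsings (suc n) r ≡ linParsings n r
  shorter wd {r} eq = linParsings-fuel n r (≤-trans (strip-word-length a t (spell-shape wd) eq) le)

term : ℕ → List Word → ℤ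
term w ws = if parsingWeight ws ≡ᵇ w then parsingCoef ws else + 0

poly : List (List Word) → ℕ → ℤ
poly L w = foldr (λ ws acc → term w ws +ℤ acc) (+ 0) L

Null : List (List Word) → Set
Null L = ∀ w → poly L w ≡ + 0

poly-++ : ∀ L M w → poly (L ++ M) w ≡ poly L w +ℤ poly M w
poly-++ []       M w = sym (+-identityˡ (poly M w))
poly-++ (ws ∷ L) M w = begin
  term w ws +ℤ poly (L ++ M) w             ≡⟨ cong (term w ws +ℤ_) (poly-++ L M w) ⟩
  term w ws +ℤ (poly L w +ℤ poly M w)      ≡⟨ sym (+-assoc (term w ws) _ _) ⟩
  (term w ws +ℤ poly L w) +ℤ poly M w      ∎
  where open ≡-Reasoning

poly-concatMap-cong : ∀ {A : Set} (f g : A → List (List Word)) → (∀ x → poly (f x) ≗ poly (g x)) →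
                      ∀ xs → poly (concatMap f xs) ≗ poly (concatMap g xs)
poly-concatMap-cong f g f≗g []       w = refl
poly-concatMap-cong f g f≗g (x ∷ xs) w = begin
  poly (f x ++ concatMap f xs) w                  ≡⟨ poly-++ (f x) _ w ⟩
  poly (f x) w +ℤ poly (concatMap f xs) w         ≡⟨ cong₂ _+ℤ_ (f≗g x w) (poly-concatMap-cong f g f≗g xs w) ⟩
  poly (g x) w +ℤ poly (concatMap g xs) w         ≡⟨ sym (poly-++ (g x) _ w) ⟩
  poly (g x ++ concatMap g xs) w                  ∎
  where open ≡-Reasoning

-- shift k f is the coefficient sequence of t^k · f.
shift : ℕ → (ℕ → ℤ) → ℕ → ℤ
shift zero    f w       = f w
shift (suc k) f zero    = + 0
shift (suc k) f (suc w) = shift k f w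

shift-cong : ∀ k f g → f ≗ g → shift k f ≗ shift k g
shift-cong zero    f g f≗g w       = f≗g w
shift-cong (suc k) f g f≗g zero    = refl
shift-cong (suc k) f g f≗g (suc w) = shift-cong k f g f≗g w

shift-zero : ∀ k w → shift k (λ _ → + 0) w ≡ + 0
shift-zero zero    w       = refl
shift-zero (suc k) zero    = refl
shift-zero (suc k) (suc w) = shift-zero k w

shift-+ : ∀ k f g w → shift k (λ v → f v +ℤ g v) w ≡ shift k f w +ℤ shift k g w
shift-+ zero    f g w       = refl
shift-+ (suc k) f g zero    = refl
shift-+ (suc k) f g (suc w) = shift-+ k f g w

shift-monomial : ∀ k n x y w →
  (if k + n ≡ᵇ w then x * y else + 0) ≡ x * shift k (λ v → if n ≡ᵇ v then y else + 0) w
shift-monomial zero    n x y w with n ≡ᵇ w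
... | true  = refl
... | false = sym (*-zeroʳ x)
shift-monomial (suc k) n x y zero    = sym (*-zeroʳ x)
shift-monomial (suc k) n x y (suc w) = shift-monomial k n x y w

poly-prefix : ∀ wd L w → poly (map (wd ∷_) L) w ≡ coef wd * shift (weight wd) (poly L) w
poly-prefix wd []       w = sym (trans (cong (coef wd *_) (shift-zero (weight wd) w)) (*-zeroʳ (coef wd)))
poly-prefix wd (ws ∷ L) w = begin
  term w (wd ∷ ws) +ℤ poly (map (wd ∷_) L) w
    ≡⟨ cong₂ _+ℤ_ (shift-monomial k (parsingWeight ws) (coef wd) (parsingCoef ws) w) (poly-prefix wd L w) ⟩
  coef wd * shift k (λ v → term v ws) w +ℤ coef wd * shift k (poly L) w
    ≡⟨ sym (*-distribˡ-+ (coef wd) _ _) ⟩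
  coef wd * (shift k (λ v → term v ws) w +ℤ shift k (poly L) w)
    ≡⟨ cong (coef wd *_) (sym (shift-+ k (λ v → term v ws) (poly L) w)) ⟩
  coef wd * shift k (poly (ws ∷ L)) w
    ∎
  where
  open ≡-Reasoning
  k = weight wd

prefix-cong : ∀ wd L M → poly L ≗ poly M → poly (map (wd ∷_) L) ≗ poly (map (wd ∷_) M)
prefix-cong wd L M L≗M w = begin
  poly (map (wd ∷_) L) w              ≡⟨ poly-prefix wd L w ⟩
  coef wd * shift (weight wd) (poly L) w ≡⟨ cong (coef wd *_) (shift-cong (weight wd) (poly L) (poly M) L≗M w) ⟩
  coef wd * shift (weight wd) (poly M) w ≡⟨ sym (poly-prefix wd M w) ⟩
  poly (map (wd ∷_) M) w              ∎
  where open ≡-Reasoning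

prefix-null : ∀ wd L → Null L → Null (map (wd ∷_) L)
prefix-null wd L L-null = prefix-cong wd L [] L-null

FirstWord : (List Word → Bool) → Set
FirstWord p = ∀ wd ws → p (wd ∷ ws) ≡ p (wd ∷ [])

-- Filtering by the constant true predicate does nothing; this lets unfiltered
-- parsing lists be treated as a special case of filtered ones.
filterᵇ-true : ∀ (L : List (List Word)) → filterᵇ (λ _ → true) L ≡ L
filterᵇ-true []       = refl
filterᵇ-true (ws ∷ L) = cong (ws ∷_) (filterᵇ-true L)

poly-filter-++ : ∀ p L M w → poly (filterᵇ p (L ++ M)) w ≡ poly (filterᵇ p L) w +ℤ poly (filterᵇ p M) w
poly-filter-++ p L M w = trans (cong (λ K → poly K w) (filter-++ (T? ∘ p) L M)) (poly-++ (filterᵇ p L) _ w)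

filter-concatMap : ∀ p {A : Set} (f : A → List (List Word)) xs →
                   filterᵇ p (concatMap f xs) ≡ concatMap (filterᵇ p ∘ f) xs
filter-concatMap p f []       = refl
filter-concatMap p f (x ∷ xs) =
  trans (filter-++ (T? ∘ p) (f x) _) (cong (filterᵇ p (f x) ++_) (filter-concatMap p f xs))

filter-prefix : ∀ p → FirstWord p → ∀ wd L →
                filterᵇ p (map (wd ∷_) L) ≡ (if p (wd ∷ []) then map (wd ∷_) L else [])
filter-prefix p fw wd [] with p (wd ∷ [])
... | true  = refl
... | false = refl
filter-prefix p fw wd (ws ∷ L) rewrite fw wd ws with p (wd ∷ []) | filter-prefix p fw wd L
... | true  | keep = cong ((wd ∷ ws) ∷_) keep
... | false | drop = drop

poly-filter-prefix : ∀ p → FirstWord p → ∀ wd L w →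
  poly (filterᵇ p (map (wd ∷_) L)) w ≡ (if p (wd ∷ []) then poly (map (wd ∷_) L) w else + 0)
poly-filter-prefix p fw wd L w with p (wd ∷ []) | filter-prefix p fw wd L
... | true  | keep = cong (λ K → poly K w) keep
... | false | drop = cong (λ K → poly K w) drop

if-cong : ∀ b {x y : ℤ} → x ≡ y → (if b then x else + 0) ≡ (if b then y else + 0)
if-cong b = cong (λ z → if b then z else + 0)

if-zero : ∀ b {x : ℤ} → x ≡ + 0 → (if b then x else + 0) ≡ + 0
if-zero true  x≡0 = x≡0
if-zero false _   = refl

parsings-XBA : ∀ k m → linParsings (3 + k) (X ∷ B ∷ A ∷ m)
  ≡ map (wX ∷_) (map (wBA ∷_) (linParsings (suc k) m)) ++ map (wXBA ∷_) (linParsings (2 + k) m)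
parsings-XBA k m = cong₂ _++_ (cong (map (wX ∷_)) (++-identityʳ (map (wBA ∷_) (linParsings (suc k) m))))
                              (++-identityʳ (map (wXBA ∷_) (linParsings (2 + k) m)))

parsings-BAX : ∀ k m → linParsings (3 + k) (B ∷ A ∷ (m ++ X ∷ []))
  ≡ map (wBA ∷_) (linParsings (2 + k) (m ++ X ∷ []))
parsings-BAX k m = ++-identityʳ (map (wBA ∷_) (linParsings (2 + k) (m ++ X ∷ [])))

-- A final X can only be parsed as the word X (coefficient 1, weight 0), so
-- it does not change the generating sum.
poly-snoc-X : ∀ n m → length m < n → poly (linParsings n (m ++ X ∷ [])) ≗ poly (linParsings n m)
poly-snoc-X (suc k) []      _        w = refl
poly-snoc-X (suc k) (a ∷ t) (s≤s le) w = begin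
  poly (linParsings (suc k) (a ∷ t ++ X ∷ [])) w  ≡⟨ cong (λ L → poly L w) (linParsings-unfold k a (t ++ X ∷ [])) ⟩
  poly (expand (linParsings k) (a ∷ t ++ X ∷ [])) w ≡⟨ poly-concatMap-cong (branches (a ∷ t ++ X ∷ [])) (branches (a ∷ t)) same-branch allWords w ⟩
  poly (expand (linParsings k) (a ∷ t)) w          ≡⟨ cong (λ L → poly L w) (sym (linParsings-unfold k a t)) ⟩
  poly (linParsings (suc k) (a ∷ t)) w             ∎
  where
  open ≡-Reasoning
  branches : List Letter → Word → List (List Word)
  branches s wd = branch wd (stripPrefix (spell wd) s) (linParsings k)
  same-branch : ∀ wd → poly (branch wd (stripPrefix (spell wd) ((a ∷ t) ++ X ∷ [])) (linParsings k))
                     ≗ poly (branch wd (stripPrefix (spell wd) (a ∷ t)) (linParsings k))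
  same-branch wd with stripPrefix (spell wd) (a ∷ t) in eq
  ... | just r  rewrite strip-++ (spell wd) (a ∷ t) (X ∷ []) eq =
        prefix-cong wd (linParsings k (r ++ X ∷ [])) (linParsings k r) (poly-snoc-X k r (≤-trans (s≤s (strip-word-length a t (spell-shape wd) eq)) le))
  ... | nothing rewrite strip-snoc-X (spell wd) (a ∷ t) eq (word-not-snoc-X a t (spell-shape wd)) = λ _ → refl

poly-XBA : ∀ p → FirstWord p → ∀ k m → length m ≤ suc k → ∀ w →
  poly (filterᵇ p (linParsings (3 + k) (X ∷ B ∷ A ∷ m))) w
    ≡ (if p (wX ∷ []) then - shift 1 (poly (linParsings (2 + k) m)) w else + 0)
      +ℤ (if p (wXBA ∷ []) then shift 1 (poly (linParsings (2 + k) m)) w else + 0)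
poly-XBA p fw k m le w = begin
  poly (filterᵇ p (linParsings (3 + k) (X ∷ B ∷ A ∷ m))) w
    ≡⟨ cong (λ L → poly (filterᵇ p L) w) (parsings-XBA k m) ⟩
  poly (filterᵇ p (map (wX ∷_) L₁ ++ map (wXBA ∷_) L₂)) w
    ≡⟨ poly-filter-++ p (map (wX ∷_) L₁) _ w ⟩
  poly (filterᵇ p (map (wX ∷_) L₁)) w +ℤ poly (filterᵇ p (map (wXBA ∷_) L₂)) w
    ≡⟨ cong₂ _+ℤ_ (trans (poly-filter-prefix p fw wX L₁ w) (if-cong (p (wX ∷ [])) via-X-BA))
                  (trans (poly-filter-prefix p fw wXBA L₂ w) (if-cong (p (wXBA ∷ [])) via-XBA)) ⟩
  (if p (wX ∷ []) then - Q else + 0) +ℤ (if p (wXBA ∷ []) then Q else + 0)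
    ∎
  where
  open ≡-Reasoning
  L₁ = map (wBA ∷_) (linParsings (suc k) m)
  L₂ = linParsings (2 + k) m
  Q = shift 1 (poly L₂) w
  via-X-BA : poly (map (wX ∷_) L₁) w ≡ - Q
  via-X-BA = begin
    poly (map (wX ∷_) L₁) w                              ≡⟨ trans (poly-prefix wX L₁ w) (*-identityˡ _) ⟩
    poly L₁ w                                            ≡⟨ trans (poly-prefix wBA (linParsings (suc k) m) w) (-1*i≡-i _) ⟩
    - shift 1 (poly (linParsings (suc k) m)) w           ≡⟨ cong (λ L → - shift 1 (poly L) w) (sym (linParsings-fuel (suc k) m le)) ⟩
    - Q                                                  ∎
  via-XBA : poly (map (wXBA ∷_) L₂) w ≡ Q
  via-XBA = trans (poly-prefix wXBA L₂ w) (*-identityˡ Q)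

poly-BAX : ∀ q → FirstWord q → ∀ k m → length m ≤ suc k → ∀ w →
  poly (filterᵇ q (linParsings (3 + k) (B ∷ A ∷ (m ++ X ∷ [])))) w
    ≡ (if q (wBA ∷ []) then - shift 1 (poly (linParsings (2 + k) m)) w else + 0)
poly-BAX q fw k m le w = begin
  poly (filterᵇ q (linParsings (3 + k) (B ∷ A ∷ (m ++ X ∷ [])))) w
    ≡⟨ cong (λ L → poly (filterᵇ q L) w) (parsings-BAX k m) ⟩
  poly (filterᵇ q (map (wBA ∷_) L)) w
    ≡⟨ poly-filter-prefix q fw wBA L w ⟩
  (if q (wBA ∷ []) then poly (map (wBA ∷_) L) w else + 0)
    ≡⟨ if-cong (q (wBA ∷ [])) (trans (poly-prefix wBA L w) (-1*i≡-i _)) ⟩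
  (if q (wBA ∷ []) then - shift 1 (poly L) w else + 0)
    ≡⟨ if-cong (q (wBA ∷ [])) (cong -_ (shift-cong 1 (poly L) (poly (linParsings (2 + k) m)) (poly-snoc-X (2 + k) m (s≤s le)) w)) ⟩
  (if q (wBA ∷ []) then - shift 1 (poly (linParsings (2 + k) m)) w else + 0)
    ∎
  where
  open ≡-Reasoning
  L = linParsings (2 + k) (m ++ X ∷ [])

-- How the blocks X and XBA at the position of an X, and BA at the position of
-- the following B, can cover position 0 of a cyclic string: XBA covers it
-- exactly when X or BA does, and X and BA never both do.
data Splits : Bool → Bool → Bool → Set where
  by-X    : Splits true  true  false
  by-BA   : Splits false true  true
  neither : Splits false false false

splits-cancel : ∀ {b₁ b₂ b₃} → Splits b₁ b₂ b₃ → ∀ Q →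
  ((if b₁ then - Q else + 0) +ℤ (if b₂ then Q else + 0)) +ℤ (if b₃ then - Q else + 0) ≡ + 0
splits-cancel by-X    Q = trans (+-identityʳ (- Q +ℤ Q)) (+-inverseˡ Q)
splits-cancel by-BA   Q = trans (cong (_+ℤ - Q) (+-identityˡ Q)) (+-inverseʳ Q)
splits-cancel neither Q = refl

-- Parsings of the linear strings XB·m and B·m·X, restricted by first-word
-- predicates obeying Splits, cancel: X·BA·… and BA·… against XBA·….
pair-cancel : ∀ p q → FirstWord p → FirstWord q → ∀ m →
  (0 < length m → Splits (p (wX ∷ [])) (p (wXBA ∷ [])) (q (wBA ∷ []))) → ∀ w →
  poly (filterᵇ p (linParsings (2 + length m) (X ∷ B ∷ m))) w
    +ℤ poly (filterᵇ q (linParsings (2 + length m) (B ∷ (m ++ X ∷ [])))) w ≡ + 0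
pair-cancel p q fp fq []      splits w = refl
pair-cancel p q fp fq (X ∷ m) splits w = refl
pair-cancel p q fp fq (B ∷ m) splits w = refl
pair-cancel p q fp fq (A ∷ m) splits w =
  trans (cong₂ _+ℤ_ (poly-XBA p fp (length m) m (m≤n⇒m≤1+n ≤-refl) w)
                    (poly-BAX q fq (length m) m (m≤n⇒m≤1+n ≤-refl) w))
        (splits-cancel (splits (s≤s z≤n)) (shift 1 (poly (linParsings (2 + length m) m)) w))

XB-start-null : ∀ n v → length v ≤ n → Null (linParsings (2 + n) (X ∷ B ∷ v))
XB-start-null n       []      _        w = refl
XB-start-null n       (X ∷ v) _        w = refl
XB-start-null n       (B ∷ v) _        w = refl
XB-start-null zero    (A ∷ m) ()
XB-start-null (suc k) (A ∷ m) (s≤s le) w = begin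
  poly (linParsings (3 + k) (X ∷ B ∷ A ∷ m)) w
    ≡⟨ cong (λ L → poly L w) (sym (filterᵇ-true (linParsings (3 + k) (X ∷ B ∷ A ∷ m)))) ⟩
  poly (filterᵇ (λ _ → true) (linParsings (3 + k) (X ∷ B ∷ A ∷ m))) w
    ≡⟨ poly-XBA (λ _ → true) (λ _ _ → refl) k m (m≤n⇒m≤1+n le) w ⟩
  - Q +ℤ Q
    ≡⟨ +-inverseˡ Q ⟩
  + 0 ∎
  where
  open ≡-Reasoning
  Q = shift 1 (poly (linParsings (2 + k) m)) w

-- Every linear string containing XB has null generating sum; and so has the
-- part of it selected by a first-word predicate when XB occurs after the
-- first letter, since the first word never reaches that occurrence.
linear-null : ∀ n {t} → HasXB t → length t ≤ n → Null (linParsings n t)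
tail-null   : ∀ n p {t} → FirstWord p → TailHasXB t → length t ≤ n → Null (filterᵇ p (linParsings n t))

linear-null zero          (here v)    ()
linear-null (suc zero)    (here v)    (s≤s ())
linear-null (suc (suc n)) (here v)    (s≤s (s≤s le)) = XB-start-null n v le
linear-null n             (there a h) le w =
  trans (cong (λ L → poly L w) (sym (filterᵇ-true (linParsings n (a ∷ _)))))
        (tail-null n (λ _ → true) (λ _ _ → refl) (after a h) le w)

tail-null zero    p fp (after a h) ()
tail-null (suc n) p {a ∷ t} fp (after a h) (s≤s le) w = begin
  poly (filterᵇ p (linParsings (suc n) (a ∷ t))) w
    ≡⟨ cong (λ L → poly (filterᵇ p L) w) (linParsings-unfold n a t) ⟩
  poly (filterᵇ p (concatMap branches allWords)) w
    ≡⟨ cong (λ L → poly L w) (filter-concatMap p branches allWords) ⟩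
  poly (concatMap (filterᵇ p ∘ branches) allWords) w
    ≡⟨ poly-concatMap-cong (filterᵇ p ∘ branches) (λ _ → []) branch-null allWords w ⟩
  + 0 ∎
  where
  open ≡-Reasoning
  branches : Word → List (List Word)
  branches wd = branch wd (stripPrefix (spell wd) (a ∷ t)) (linParsings n)
  branch-null : ∀ wd → Null (filterᵇ p (branches wd))
  branch-null wd with stripPrefix (spell wd) (a ∷ t) in eq
  ... | nothing = λ _ → refl
  ... | just r  = λ w → trans (poly-filter-prefix p fp wd (linParsings n r) w)
                              (if-zero (p (wd ∷ [])) (prefix-null wd (linParsings n r) rest-null w))
    where
    rest-null : Null (linParsings n r)
    rest-null = linear-null n (strip-word-keeps-XB (spell-shape wd) (after a h) eq)
                              (≤-trans (strip-word-length a t (spell-shape wd) eq) le)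

Σ< : ℕ → (ℕ → ℤ) → ℤ
Σ< zero    g = + 0
Σ< (suc n) g = g 0 +ℤ Σ< n (g ∘ suc)

Σ<-+ : ∀ m n g → Σ< (m + n) g ≡ Σ< m g +ℤ Σ< n (λ j → g (m + j))
Σ<-+ zero    n g = sym (+-identityˡ (Σ< n g))
Σ<-+ (suc m) n g = trans (cong (g 0 +ℤ_) (Σ<-+ m n (g ∘ suc)))
                         (sym (+-assoc (g 0) (Σ< m (g ∘ suc)) _))

Σ<-zero : ∀ n g → (∀ i → i < n → g i ≡ + 0) → Σ< n g ≡ + 0
Σ<-zero zero    g g≡0 = refl
Σ<-zero (suc n) g g≡0 = cong₂ _+ℤ_ (g≡0 0 (s≤s z≤n)) (Σ<-zero n (g ∘ suc) (λ i i<n → g≡0 (suc i) (s≤s i<n)))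

poly-concatMap-applyUpTo : ∀ (f : ℕ → List (List Word)) h n w →
  poly (concatMap f (applyUpTo h n)) w ≡ Σ< n (λ i → poly (f (h i)) w)
poly-concatMap-applyUpTo f h zero    w = refl
poly-concatMap-applyUpTo f h (suc n) w =
  trans (poly-++ (f (h 0)) _ w) (cong (poly (f (h 0)) w +ℤ_) (poly-concatMap-applyUpTo f (h ∘ suc) n w))

rotationTerm : List Letter → ℕ → ℕ → ℤ
rotationTerm s w r = poly (filterᵇ (coversZero (length s) r) (linParsings (length s) (rotate r s))) w

c-as-sum : ∀ s w → c s w ≡ Σ< (length s) (rotationTerm s w)
c-as-sum s w = poly-concatMap-applyUpTo
  (λ r → filterᵇ (coversZero (length s) r) (linParsings (length s) (rotate r s))) (λ r → r) (length s) w

length-rotate : ∀ r (s : List Letter) → length (rotate r s) ≡ length s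
length-rotate r s = begin
  length (drop r s ++ take r s)        ≡⟨ length-++ (drop r s) ⟩
  length (drop r s) + length (take r s) ≡⟨ cong₂ _+_ (length-drop r s) (length-take r s) ⟩
  (length s ∸ r) + (r ⊓ length s)      ≡⟨ ℕ.+-comm (length s ∸ r) _ ⟩
  (r ⊓ length s) + (length s ∸ r)      ≡⟨ m⊓n+n∸m≡n r (length s) ⟩
  length s                             ∎
  where open ≡-Reasoning

rotation-null : ∀ s w r → TailHasXB (rotate r s) → rotationTerm s w r ≡ + 0
rotation-null s w r h =
  tail-null (length s) (coversZero (length s) r) (λ _ _ → refl) h (≤-reflexive (length-rotate r s)) w

rotation-pair : ∀ s m r₁ r₂ → length s ≡ 2 + length m →
  rotate r₁ s ≡ X ∷ B ∷ m → rotate r₂ s ≡ B ∷ (m ++ X ∷ []) →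
  (0 < length m → Splits (coversZero (length s) r₁ (wX ∷ [])) (coversZero (length s) r₁ (wXBA ∷ []))
                         (coversZero (length s) r₂ (wBA ∷ []))) →
  ∀ w → rotationTerm s w r₁ +ℤ rotationTerm s w r₂ ≡ + 0
rotation-pair s m r₁ r₂ len rot₁ rot₂ splits w =
  trans (cong₂ _+ℤ_ (cong₂ (λ n t → poly (filterᵇ p₁ (linParsings n t)) w) len rot₁)
                    (cong₂ (λ n t → poly (filterᵇ p₂ (linParsings n t)) w) len rot₂))
        (pair-cancel p₁ p₂ (λ _ _ → refl) (λ _ _ → refl) m splits w)
  where
  p₁ = coversZero (length s) r₁
  p₂ = coversZero (length s) r₂

drop-++ˡ : ∀ {A : Set} i (u y : List A) → i ≤ length u → drop i (u ++ y) ≡ drop i u ++ y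
drop-++ˡ zero    u       y _        = refl
drop-++ˡ (suc i) (x ∷ u) y (s≤s le) = drop-++ˡ i u y le

drop-++-length : ∀ {A : Set} j (u y : List A) → drop (length u + j) (u ++ y) ≡ drop j y
drop-++-length j []      y = refl
drop-++-length j (x ∷ u) y = drop-++-length j u y

take-++-length : ∀ {A : Set} j (u y : List A) → take (length u + j) (u ++ y) ≡ u ++ take j y
take-++-length j []      y = refl
take-++-length j (x ∷ u) y = cong (x ∷_) (take-++-length j u y)

length-++-∸ : ∀ {A : Set} (u y : List A) j → length (u ++ y) ∸ (length u + j) ≡ length y ∸ j
length-++-∸ []      y j = refl
length-++-∸ (x ∷ u) y j = length-++-∸ u y j

drop-nonempty : ∀ {A : Set} i (u : List A) → i < length u → ∃₂ λ x xs → drop i u ≡ x ∷ xs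
drop-nonempty zero    (x ∷ u) _        = x , u , refl
drop-nonempty (suc i) (x ∷ u) (s≤s lt) = drop-nonempty i u lt

data XBShape : List Letter → Set where
  inner : ∀ u d → XBShape (u ++ X ∷ B ∷ d)
  wraps : ∀ m → XBShape (B ∷ (m ++ X ∷ []))

xb-shape : ∀ s → ContainsXB s → XBShape s
xb-shape s (r , r<len , rest , rot≡) with drop r s in drop≡
... | []        = ⊥-elim (n≮0 (subst (0 <_) (trans (sym (length-drop r s)) (cong length drop≡)) (m<n⇒0<n∸m r<len)))
... | X ∷ []    = subst XBShape s≡ (wraps rest)
  where
  s≡ : B ∷ (rest ++ X ∷ []) ≡ s
  s≡ = trans (cong₂ _++_ (sym (cong (drop 1) rot≡)) (sym drop≡)) (take++drop≡id r s)
... | X ∷ B ∷ d = subst XBShape (trans (cong (take r s ++_) (sym drop≡)) (take++drop≡id r s)) (inner (take r s) d)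
... | X ∷ A ∷ d with () ← rot≡
... | X ∷ X ∷ d with () ← rot≡
... | A ∷ d     with () ← rot≡
... | B ∷ d     with () ← rot≡

rotate-inner-before : ∀ u d i → i < length u → TailHasXB (rotate i (u ++ X ∷ B ∷ d))
rotate-inner-before u d i i<u with drop-nonempty i u i<u
... | x , xs , drop≡ rewrite drop-++ˡ i u (X ∷ B ∷ d) (<⇒≤ i<u) | drop≡ =
  after x (HasXB-++ʳ (take i (u ++ X ∷ B ∷ d)) (HasXB-++ˡ xs (here d)))

rotate-inner-after : ∀ u d j → j < length d → TailHasXB (rotate (length u + (2 + j)) (u ++ X ∷ B ∷ d))
rotate-inner-after u d j j<d
  rewrite drop-++-length (2 + j) u (X ∷ B ∷ d) | take-++-length (2 + j) u (X ∷ B ∷ d)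
  with drop-nonempty j d j<d
... | x , xs , drop≡ rewrite drop≡ = after x (HasXB-++ˡ xs (HasXB-++ˡ u (here (take j d))))

rotate-inner-X : ∀ u d → rotate (length u + 0) (u ++ X ∷ B ∷ d) ≡ X ∷ B ∷ (d ++ u)
rotate-inner-X u d = trans (cong₂ _++_ (drop-++-length 0 u (X ∷ B ∷ d)) (take-++-length 0 u (X ∷ B ∷ d)))
                           (cong (λ z → X ∷ B ∷ (d ++ z)) (++-identityʳ u))

rotate-inner-B : ∀ u d → rotate (length u + 1) (u ++ X ∷ B ∷ d) ≡ B ∷ ((d ++ u) ++ X ∷ [])
rotate-inner-B u d = trans (cong₂ _++_ (drop-++-length 1 u (X ∷ B ∷ d)) (take-++-length 1 u (X ∷ B ∷ d)))
                           (cong (B ∷_) (sym (++-assoc d u (X ∷ []))))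

-- Position 0 of u·XB·d is covered by X at |u| iff u is empty, and by BA at
-- |u| + 1 iff d is empty; both cannot happen when d·u is nonempty.
splits-inner : ∀ u d → 0 < length (d ++ u) →
  let N = length (u ++ X ∷ B ∷ d) in
  Splits (coversZero N (length u + 0) (wX ∷ [])) (coversZero N (length u + 0) (wXBA ∷ []))
         (coversZero N (length u + 1) (wBA ∷ []))
splits-inner []      (y ∷ d) _ = by-X
splits-inner (x ∷ u) []      _ rewrite length-++-∸ u (X ∷ B ∷ []) 0 | length-++-∸ u (X ∷ B ∷ []) 1 = by-BA
splits-inner (x ∷ u) (y ∷ d) _ rewrite length-++-∸ u (X ∷ B ∷ y ∷ d) 0 | length-++-∸ u (X ∷ B ∷ y ∷ d) 1 = neither

inner-vanishes : ∀ u d → IsZeroPoly (u ++ X ∷ B ∷ d)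
inner-vanishes u d w = begin
  c s w                                     ≡⟨ c-as-sum s w ⟩
  Σ< (length s) g                           ≡⟨ cong (λ n → Σ< n g) (length-++ u) ⟩
  Σ< (a + (2 + length d)) g                 ≡⟨ Σ<-+ a (2 + length d) g ⟩
  Σ< a g +ℤ (g (a + 0) +ℤ (g (a + 1) +ℤ Σ< (length d) (λ j → g (a + (2 + j)))))
    ≡⟨ cong₂ (λ x y → x +ℤ (g (a + 0) +ℤ (g (a + 1) +ℤ y))) in-u in-d ⟩
  + 0 +ℤ (g (a + 0) +ℤ (g (a + 1) +ℤ + 0)) ≡⟨ trans (+-identityˡ _) (cong (g (a + 0) +ℤ_) (+-identityʳ _)) ⟩
  g (a + 0) +ℤ g (a + 1)                    ≡⟨ rotation-pair s (d ++ u) (a + 0) (a + 1) (length-++-comm u (X ∷ B ∷ d))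
                                                 (rotate-inner-X u d) (rotate-inner-B u d) (splits-inner u d) w ⟩
  + 0                                       ∎
  where
  open ≡-Reasoning
  s = u ++ X ∷ B ∷ d
  a = length u
  g = rotationTerm s w
  in-u : Σ< a g ≡ + 0
  in-u = Σ<-zero a g (λ i i<a → rotation-null s w i (rotate-inner-before u d i i<a))
  in-d : Σ< (length d) (λ j → g (a + (2 + j))) ≡ + 0
  in-d = Σ<-zero (length d) _ (λ j j<d → rotation-null s w (a + (2 + j)) (rotate-inner-after u d j j<d))

rotate-wraps-middle : ∀ m i → i < length m → TailHasXB (rotate (suc i) (B ∷ (m ++ X ∷ [])))
rotate-wraps-middle m i i<m with drop-nonempty i m i<m
... | x , xs , drop≡ rewrite drop-++ˡ i m (X ∷ []) (<⇒≤ i<m) | drop≡ =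
  after x (subst HasXB (sym (++-assoc xs (X ∷ []) (B ∷ z))) (HasXB-++ˡ xs (here z)))
  where z = take i (m ++ X ∷ [])

rotate-wraps-X : ∀ m → rotate (suc (length m + 0)) (B ∷ (m ++ X ∷ [])) ≡ X ∷ B ∷ m
rotate-wraps-X m = trans (cong₂ (λ y z → y ++ B ∷ z) (drop-++-length 0 m (X ∷ [])) (take-++-length 0 m (X ∷ [])))
                         (cong (λ z → X ∷ B ∷ z) (++-identityʳ m))

splits-wraps : ∀ m → let N = length (B ∷ (m ++ X ∷ [])) in
  Splits (coversZero N (suc (length m + 0)) (wX ∷ [])) (coversZero N (suc (length m + 0)) (wXBA ∷ []))
         (coversZero N 0 (wBA ∷ []))
splits-wraps m rewrite length-++-∸ m (X ∷ []) 0 = by-BA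

wraps-vanishes : ∀ m → IsZeroPoly (B ∷ (m ++ X ∷ []))
wraps-vanishes m w = begin
  c s w                                        ≡⟨ c-as-sum s w ⟩
  g 0 +ℤ Σ< (length (m ++ X ∷ [])) (g ∘ suc)   ≡⟨ cong (λ n → g 0 +ℤ Σ< n (g ∘ suc)) (length-++ m) ⟩
  g 0 +ℤ Σ< (length m + 1) (g ∘ suc)           ≡⟨ cong (g 0 +ℤ_) (Σ<-+ (length m) 1 (g ∘ suc)) ⟩
  g 0 +ℤ (Σ< (length m) (g ∘ suc) +ℤ (g r +ℤ + 0)) ≡⟨ cong (λ x → g 0 +ℤ (x +ℤ (g r +ℤ + 0))) in-m ⟩
  g 0 +ℤ (+ 0 +ℤ (g r +ℤ + 0))                  ≡⟨ cong (g 0 +ℤ_) (trans (+-identityˡ _) (+-identityʳ _)) ⟩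
  g 0 +ℤ g r                                   ≡⟨ +-comm (g 0) (g r) ⟩
  g r +ℤ g 0                                   ≡⟨ rotation-pair s m r 0 len (rotate-wraps-X m) (++-identityʳ s)
                                                    (λ _ → splits-wraps m) w ⟩
  + 0                                          ∎
  where
  open ≡-Reasoning
  s = B ∷ (m ++ X ∷ [])
  r = suc (length m + 0)
  g = rotationTerm s w
  len : length s ≡ 2 + length m
  len = cong suc (trans (length-++ m) (ℕ.+-comm (length m) 1))
  in-m : Σ< (length m) (g ∘ suc) ≡ + 0
  in-m = Σ<-zero (length m) (g ∘ suc) (λ i i<m → rotation-null s w (suc i) (rotate-wraps-middle m i i<m))

lemma4p2 : (s : List Letter) → ContainsXB s → IsZeroPoly s
lemma4p2 s xb with xb-shape s xb
... | inner u d = inner-vanishes u d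
... | wraps m   = wraps-vanishes m
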